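{- Let $G$ be a $3$-regular graph on $n$ vertices such that some graph not isomorphic to $G$ has the same $(n-2)$-deck as $G$. Call any graph whose $(n-2)$-deck equals that of $G$ a reconstruction. Then: (1) If $x,y$ are adjacent vertices of $G$, then for every reconstruction $R$ and every pair of distinct vertices $x',y'\in V(R)$ with $R-\{x',y'\}\cong G-\{x,y\}$, the vertices $x'$ and $y'$ are adjacent in $R$. (2) If $x,y$ are distinct vertices of $G$ with a common neighbor $z$, then for every reconstruction $R$, every pair of distinct $x',y'\in V(R)$ and every isomorphism $\varphi\colon R-\{x',y'\}\to G-\{x,y\}$, both $x'$ and $y'$ are adjacent in $R$ to $\varphi^{ -1}(z)$. (3) Every reconstruction (in particular $G$ itself) has girth at least $5$.
   Context: All graphs are finite and simple. For a graph on $n$ vertices, its $(n-2)$-deck is the multiset (of isomorphism classes) of its $\binom{n}{2}$ induced subgraphs on $n-2$ vertices, i.e. the subgraphs obtained by deleting two vertices. The girth of a graph is the length of a shortest cycle. -}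

module Defs where

open import Data.Nat using (ℕ; zero; suc; _+_; _≤_; _<_)
open import Data.Fin using (Fin; toℕ; _≟_; _<?_)
open import Data.Fin.Properties using ()
open import Data.Bool using (Bool; true; false; T; not; _∧_; if_then_else_)
open import Data.List using (List; map; allFin)
open import Data.Nat.ListAction using (sum)
open import Data.Nat.DivMod using (_mod_)
open import Data.Product using (Σ; _×_; _,_; proj₁; proj₂; ∃)
open import Function.Bundles using (_↔_; Inverse)
open import Relation.Binary.PropositionalEquality using (_≡_; _≢_)
open import Relation.Nullary using (¬_)
open import Relation.Nullary.Decidable using (⌊_⌋)

record Graph (n : ℕ) : Set where
  field
    adj    : Fin n → Fin n → Bool
    sym    : ∀ x y → adj x y ≡ adj y x
    irrefl : ∀ x → adj x x ≡ false
open Graph public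

_≅_ : ∀ {n} → Graph n → Graph n → Set
_≅_ {n} G H = Σ (Fin n ↔ Fin n) λ φ →
  ∀ u v → adj G u v ≡ adj H (Inverse.to φ u) (Inverse.to φ v)

degree : ∀ {n} → Graph n → Fin n → ℕ
degree {n} G v = sum (map (λ w → if adj G v w then 1 else 0) (allFin n))

Regular : ∀ {n} → ℕ → Graph n → Set
Regular {n} d G = ∀ (v : Fin n) → degree G v ≡ d

Del : ∀ (n : ℕ) → Fin n → Fin n → Set
Del n x y = Σ (Fin n) λ v → T (not ⌊ v ≟ x ⌋ ∧ not ⌊ v ≟ y ⌋)

DelIso : ∀ {n m} → (G : Graph n) → Fin n → Fin n → (H : Graph m) → Fin m → Fin m → Set
DelIso {n} {m} G x y H x' y' = Σ (Del n x y ↔ Del m x' y') λ φ →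
  ∀ u v → adj G (proj₁ u) (proj₁ v)
          ≡ adj H (proj₁ (Inverse.to φ u)) (proj₁ (Inverse.to φ v))

-- Unordered pairs of distinct vertices, represented as (x , y) with x < y.
Pair : ℕ → Set
Pair n = Σ (Fin n × Fin n) λ p → T ⌊ proj₁ p <? proj₂ p ⌋

-- Same (n-2)-deck: the multisets of isomorphism classes of cards agree,
-- i.e. there is a bijection between the card-indexing pairs matching
-- each card of G with an isomorphic card of H.
SameDeck : ∀ {n} → Graph n → Graph n → Set
SameDeck {n} G H = Σ (Pair n ↔ Pair n) λ σ →
  ∀ (p : Pair n) →
    DelIso G (proj₁ (proj₁ p)) (proj₂ (proj₁ p))
           H (proj₁ (proj₁ (Inverse.to σ p))) (proj₂ (proj₁ (Inverse.to σ p)))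

sucMod : ∀ {m} → Fin m → Fin m
sucMod {suc m} i = suc (toℕ i) mod suc m

HasCycle : ∀ {n} → Graph n → ℕ → Set
HasCycle {n} G m = Σ (Fin m → Fin n) λ f →
  (∀ i j → f i ≡ f j → i ≡ j) × (∀ i → adj G (f i) (f (sucMod i)) ≡ true)

-- girth ≥ k : no cycle of length ℓ with 3 ≤ ℓ < k (acyclic graphs have infinite girth).
GirthAtLeast : ∀ {n} → ℕ → Graph n → Set
GirthAtLeast k G = ∀ ℓ → 3 ≤ ℓ → ℓ < k → ¬ HasCycle G ℓ

-- A card G − {x, y} records, for every remaining vertex, its degree inside the card; in a cubic
-- graph this is 3 minus its deficit, the number of deleted vertices it is adjacent to. Matching
-- the cards of a reconstruction R with those of G bounds every degree of R between 3 and 5,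
-- and forces degree 3 once R has at least eight vertices; on six vertices a vertex of larger
-- degree would create a diamond (K₄ minus an edge), and deleting the two other vertices leaves
-- a card with two vertices of card degree 3, impossible in a cubic graph on six vertices;
-- orders 5 and 7 are odd. So R is cubic, and card isomorphisms between cubic graphs preserve deficits. The
-- total deficit of a card is 6 − 2·[x ~ y], which gives (1), and deficit 2 characterises the
-- common neighbours of x and y, which gives (2). For (3), a triangle or a 4-cycle through x
-- and y lets the card isomorphism, extended by x ↦ x', y ↦ y' (after possibly swapping x' and
-- y'), map the three neighbours of x to neighbours of x'; deficits then do the same for y, so
-- the extension is an isomorphism. Then R would be isomorphic to every reconstruction,
-- contradicting the existence of a non-isomorphic one.

module Submission where

open import Defs renaming (sym to adj-sym; irrefl to adj-irrefl)
open import Data.Bool using (Bool; true; false; not; _∧_; if_then_else_)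
open import Data.Bool.Properties using (T-irrelevant; T-≡; ∧-zeroʳ)
open import Data.Empty using (⊥; ⊥-elim)
open import Data.Fin using (Fin; zero; suc; _≟_)
open import Data.Fin.Patterns using (0F; 1F; 2F; 3F)
open import Data.Fin.Properties using (suc-injective; <-cmp; <⇒≢)
open import Data.List using (List; []; _∷_; length; tabulate)
open import Data.List.Properties using (map-tabulate)
open import Data.List.Relation.Unary.All using (All; []; _∷_; zipWith)
import Data.List.Relation.Unary.All as All
open import Data.List.Relation.Unary.AllPairs using ([]; _∷_)
open import Data.List.Relation.Unary.Unique.Propositional using (Unique)
open import Data.Nat using (ℕ; zero; suc; _+_; _*_; _≤_; _<_; z≤n; s≤s)
open import Data.Nat.Properties
  using (+-0-commutativeMonoid; +-commutativeSemigroup; +-assoc; +-mono-≤; +-monoˡ-≤; ≤-trans;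
         ≤-reflexive; m≤m+n; m≤n+m; m<m+n; +-cancelʳ-≡; +-cancelˡ-≡; +-monoʳ-≤; 1+n≰n; <⇒≱; ≤-refl;
         even≢odd; ≤-antisym; ≤-pred; ≰⇒>; _≤?_; n≤0⇒n≡0; m+n≡0⇒m≡0; m+n≡0⇒n≡0; +-cancelʳ-≤;
         +-identityʳ; +-suc; +-cancelˡ-≤; module ≤-Reasoning)
open import Data.Nat.ListAction using () renaming (sum to ListSum)
open import Data.Product using (Σ; _×_; _,_; proj₁; proj₂; ∃)
open import Data.Sum using (_⊎_; inj₁; inj₂)
open import Data.Nat.Tactic.RingSolver using (solve-∀)
open import Function.Bundles using (_↔_; Inverse; Injection; Equivalence; mk↔ₛ′)
open import Function.Base using (case_of_)
open import Function.Properties.Inverse using (↔-sym; ↔-trans; ↔⇒↣)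
open import Relation.Binary.PropositionalEquality
open import Relation.Nullary using (¬_; yes; no)
open import Relation.Nullary.Decidable using (⌊_⌋; ⌊⌋-map′; toWitness; fromWitness)
open import Relation.Binary.Definitions using (tri<; tri≈; tri>)

open import Algebra.Properties.CommutativeMonoid.Sum +-0-commutativeMonoid
  using (sum; sum-cong-≗; sum-permute; ∑-distrib-+)
open import Algebra.Properties.CommutativeSemigroup +-commutativeSemigroup
  using (x∙yz≈y∙xz; interchange)

private variable
  n : ℕ

-- Counting

𝟙 : Bool → ℕ
𝟙 b = if b then 1 else 0

count : (Fin n → Bool) → ℕ
count p = sum (λ w → 𝟙 (p w))

𝟙-∧ : ∀ b c → 𝟙 (b ∧ c) ≡ (if b then 𝟙 c else 0)
𝟙-∧ true  c = refl
𝟙-∧ false c = refl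

∧-true : ∀ {b c} → b ∧ c ≡ true → b ≡ true × c ≡ true
∧-true {true} c≡true = refl , c≡true

not-true : ∀ {b} → not b ≡ true → b ≡ false
not-true {false} _ = refl

𝟙-injective : ∀ {b c} → 𝟙 b ≡ 𝟙 c → b ≡ c
𝟙-injective {false} {false} _ = refl
𝟙-injective {true}  {true}  _ = refl
𝟙-injective {true}  {false} ()
𝟙-injective {false} {true}  ()

𝟙-double-injective : ∀ b c → 𝟙 b + 𝟙 b ≡ 𝟙 c + 𝟙 c → b ≡ c
𝟙-double-injective false false _ = refl
𝟙-double-injective true  true  _ = refl
𝟙-double-injective true  false ()
𝟙-double-injective false true  ()

𝟙+𝟙≡2 : ∀ {b c} → 𝟙 b + 𝟙 c ≡ 2 → b ≡ true × c ≡ true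
𝟙+𝟙≡2 {true}  {true}  _ = refl , refl
𝟙+𝟙≡2 {true}  {false} ()
𝟙+𝟙≡2 {false} {true}  ()
𝟙+𝟙≡2 {false} {false} ()

𝟙+𝟙≥1 : ∀ {b c} → 1 ≤ 𝟙 b + 𝟙 c → b ≡ true ⊎ c ≡ true
𝟙+𝟙≥1 {true}          _ = inj₁ refl
𝟙+𝟙≥1 {false} {true}  _ = inj₂ refl
𝟙+𝟙≥1 {false} {false} ()

_≢ᵇ_ : Fin n → Fin n → Bool
w ≢ᵇ a = not ⌊ w ≟ a ⌋

≢ᵇ-refl : (a : Fin n) → a ≢ᵇ a ≡ false
≢ᵇ-refl a with a ≟ a
... | yes _   = refl
... | no a≢a = ⊥-elim (a≢a refl)

≢⇒≢ᵇ : {w a : Fin n} → w ≢ a → w ≢ᵇ a ≡ true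
≢⇒≢ᵇ {w = w} {a} w≢a with w ≟ a
... | yes w≡a = ⊥-elim (w≢a w≡a)
... | no _    = refl

≢ᵇ⇒≢ : {w a : Fin n} → w ≢ᵇ a ≡ true → w ≢ a
≢ᵇ⇒≢ {w = w} w≢ᵇw refl with () ← trans (sym w≢ᵇw) (≢ᵇ-refl w)

≢ᵇ-suc : (w a : Fin n) → suc w ≢ᵇ suc a ≡ w ≢ᵇ a
≢ᵇ-suc w a = cong not (⌊⌋-map′ (cong suc) suc-injective (w ≟ a))

sum-split : (a : Fin n) (f : Fin n → ℕ) → sum f ≡ f a + sum (λ w → if w ≢ᵇ a then f w else 0)
sum-split {suc n} zero    f = refl
sum-split {suc n} (suc a) f = begin
  f zero + sum (λ w → f (suc w))
    ≡⟨ cong (f zero +_) (sum-split a (λ w → f (suc w))) ⟩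
  f zero + (f (suc a) + sum (λ w → if w ≢ᵇ a then f (suc w) else 0))
    ≡⟨ x∙yz≈y∙xz (f zero) (f (suc a)) _ ⟩
  f (suc a) + (f zero + sum (λ w → if w ≢ᵇ a then f (suc w) else 0))
    ≡⟨ cong (λ s → f (suc a) + (f zero + s))
            (sum-cong-≗ λ w → cong (if_then f (suc w) else 0) (sym (≢ᵇ-suc w a))) ⟩
  f (suc a) + (f zero + sum (λ w → if suc w ≢ᵇ suc a then f (suc w) else 0)) ∎
  where open ≡-Reasoning

count-split : (a : Fin n) (p : Fin n → Bool) → count p ≡ 𝟙 (p a) + count (λ w → w ≢ᵇ a ∧ p w)
count-split a p = trans (sum-split a (λ w → 𝟙 (p w)))
  (cong (𝟙 (p a) +_) (sum-cong-≗ λ w → sym (𝟙-∧ (w ≢ᵇ a) (p w))))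

sum-mono : {f g : Fin n → ℕ} → (∀ w → f w ≤ g w) → sum f ≤ sum g
sum-mono {zero}  _   = z≤n
sum-mono {suc n} f≤g = +-mono-≤ (f≤g zero) (sum-mono (λ w → f≤g (suc w)))

count-mono : {p q : Fin n → Bool} → (∀ w → p w ≡ true → q w ≡ true) → count p ≤ count q
count-mono {p = p} {q} p⇒q = sum-mono λ w → 𝟙-mono (p w) (q w) (p⇒q w)
  where
  𝟙-mono : ∀ b c → (b ≡ true → c ≡ true) → 𝟙 b ≤ 𝟙 c
  𝟙-mono false c _   = z≤n
  𝟙-mono true  c b⇒c rewrite b⇒c refl = s≤s z≤n

count-all : ∀ n → count {n} (λ _ → true) ≡ n
count-all zero    = refl
count-all (suc n) = cong suc (count-all n)

count-compl : (p : Fin n → Bool) → count p + count (λ w → not (p w)) ≡ n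
count-compl {n} p = begin
  count p + count (λ w → not (p w))  ≡⟨ ∑-distrib-+ (λ w → 𝟙 (p w)) (λ w → 𝟙 (not (p w))) ⟨
  sum (λ w → 𝟙 (p w) + 𝟙 (not (p w)))  ≡⟨ sum-cong-≗ (λ w → 𝟙-compl (p w)) ⟩
  count {n} (λ _ → true)               ≡⟨ count-all n ⟩
  n                                    ∎
  where
  open ≡-Reasoning
  𝟙-compl : ∀ b → 𝟙 b + 𝟙 (not b) ≡ 1
  𝟙-compl true  = refl
  𝟙-compl false = refl

count-witness : (p : Fin n → Bool) → 1 ≤ count p → ∃ λ w → p w ≡ true
count-witness {suc n} p pos with p zero in p0
... | true  = zero , p0
... | false = let w , pw = count-witness (λ w → p (suc w)) pos in suc w , pw

count-witnesses₂ : (p : Fin n → Bool) → 2 ≤ count p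
                 → Σ (Fin n) λ a → Σ (Fin n) λ b → a ≢ b × p a ≡ true × p b ≡ true
count-witnesses₂ p two =
  let a , pa = count-witness p (≤-trans (s≤s z≤n) two)
      others : 1 + 1 ≤ 1 + count (λ w → w ≢ᵇ a ∧ p w)
      others = subst (2 ≤_) (trans (count-split a p) (cong (λ b → 𝟙 b + count (λ w → w ≢ᵇ a ∧ p w)) pa)) two
      b , b≢a∧pb = count-witness (λ w → w ≢ᵇ a ∧ p w) (+-cancelˡ-≤ 1 1 _ others)
      b≢ᵇa , pb = ∧-true {b ≢ᵇ a} b≢a∧pb
  in a , b , ≢-sym (≢ᵇ⇒≢ b≢ᵇa) , pa , pb

count-≥-length : {p : Fin n → Bool} {ss : List (Fin n)}
               → Unique ss → All (λ s → p s ≡ true) ss → length ss ≤ count p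
count-≥-length {ss = []}             _              _          = z≤n
count-≥-length {p = p} {ss = s ∷ ss} (s≢ss ∷ uss) (ps ∷ pss) = begin
  suc (length ss)                      ≤⟨ s≤s (count-≥-length uss (zipWith rest (s≢ss , pss))) ⟩
  suc (count (λ w → w ≢ᵇ s ∧ p w))    ≡⟨ cong (λ b → 𝟙 b + count (λ w → w ≢ᵇ s ∧ p w)) ps ⟨
  𝟙 (p s) + count (λ w → w ≢ᵇ s ∧ p w) ≡⟨ count-split s p ⟨
  count p                              ∎
  where
  open ≤-Reasoning
  rest : ∀ {t} → s ≢ t × p t ≡ true → (t ≢ᵇ s ∧ p t) ≡ true
  rest (s≢t , pt) rewrite ≢⇒≢ᵇ (≢-sym s≢t) = pt

count-≤-avoiding : {p : Fin n → Bool} {ss : List (Fin n)}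
                 → Unique ss → All (λ s → p s ≡ false) ss → count p + length ss ≤ n
count-≤-avoiding {p = p} {ss} uss ¬pss = begin
  count p + length ss               ≤⟨ +-monoʳ-≤ (count p) (count-≥-length uss (All.map (cong not) ¬pss)) ⟩
  count p + count (λ w → not (p w)) ≡⟨ count-compl p ⟩
  _                                 ∎
  where open ≤-Reasoning

count-partition : (p q : Fin n → Bool)
                → count p ≡ count (λ w → p w ∧ q w) + count (λ w → p w ∧ not (q w))
count-partition p q = trans (sum-cong-≗ λ w → 𝟙-partition (p w) (q w))
                            (∑-distrib-+ (λ w → 𝟙 (p w ∧ q w)) (λ w → 𝟙 (p w ∧ not (q w))))
  where
  𝟙-partition : ∀ b c → 𝟙 b ≡ 𝟙 (b ∧ c) + 𝟙 (b ∧ not c)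
  𝟙-partition false c     = refl
  𝟙-partition true  true  = refl
  𝟙-partition true  false = refl

count≤1-unique : {p : Fin n → Bool} → count p ≤ 1 → {a b : Fin n} → p a ≡ true → p b ≡ true → a ≡ b
count≤1-unique count≤1 {a} {b} pa pb with a ≟ b
... | yes a≡b = a≡b
... | no a≢b  = ⊥-elim (1+n≰n (≤-trans (count-≥-length ((a≢b ∷ []) ∷ [] ∷ []) (pa ∷ pb ∷ [])) count≤1))

outside : List (Fin n) → Fin n → Bool
outside []       w = true
outside (s ∷ ss) w = w ≢ᵇ s ∧ outside ss w

outside-≢ : (ss : List (Fin n)) {w : Fin n} → outside ss w ≡ true → All (w ≢_) ss
outside-≢ []       _   = []
outside-≢ (s ∷ ss) out = let w≢ᵇs , out′ = ∧-true out in ≢ᵇ⇒≢ w≢ᵇs ∷ outside-≢ ss out′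

≢-outside : (ss : List (Fin n)) {w : Fin n} → All (w ≢_) ss → outside ss w ≡ true
≢-outside []       []            = refl
≢-outside (s ∷ ss) (w≢s ∷ w≢ss) rewrite ≢⇒≢ᵇ w≢s = ≢-outside ss w≢ss

count-outside : {ss : List (Fin n)} → Unique ss → count (outside ss) + length ss ≡ n
count-outside {ss = []}     []           = trans (+-identityʳ _) (count-all _)
count-outside {ss = s ∷ ss} (s≢ss ∷ uss) = begin
  count (outside (s ∷ ss)) + suc (length ss)    ≡⟨ +-suc _ (length ss) ⟩
  suc (count (outside (s ∷ ss)) + length ss)    ≡⟨ cong (λ b → 𝟙 b + count (outside (s ∷ ss)) + length ss)
                                                        (≢-outside ss s≢ss) ⟨
  𝟙 (outside ss s) + count (outside (s ∷ ss)) + length ss ≡⟨ cong (_+ length ss) (count-split s (outside ss)) ⟨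
  count (outside ss) + length ss                ≡⟨ count-outside uss ⟩
  _                                             ∎
  where open ≡-Reasoning

unique₃ : {a b c : Fin n} → a ≢ b → a ≢ c → b ≢ c → Unique (a ∷ b ∷ c ∷ [])
unique₃ a≢b a≢c b≢c = (a≢b ∷ a≢c ∷ []) ∷ (b≢c ∷ []) ∷ [] ∷ []

unique₄ : {a b c d : Fin n} → a ≢ b → a ≢ c → a ≢ d → b ≢ c → b ≢ d → c ≢ d → Unique (a ∷ b ∷ c ∷ d ∷ [])
unique₄ a≢b a≢c a≢d b≢c b≢d c≢d = (a≢b ∷ a≢c ∷ a≢d ∷ []) ∷ unique₃ b≢c b≢d c≢d

𝟙≤1 : ∀ b → 𝟙 b ≤ 1
𝟙≤1 true  = s≤s z≤n
𝟙≤1 false = z≤n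

witness-avoiding : (p : Fin n → Bool) → 3 ≤ count p → (s t : Fin n) → ∃ λ w → p w ≡ true × w ≢ s × w ≢ t
witness-avoiding p three s t =
  let w , pw′ = count-witness rest (+-cancelˡ-≤ 2 1 (count rest) (begin
        3                                                        ≤⟨ three ⟩
        count p                                                  ≡⟨ count-split s p ⟩
        𝟙 (p s) + count (λ w → w ≢ᵇ s ∧ p w)                     ≡⟨ cong (𝟙 (p s) +_) (count-split t _) ⟩
        𝟙 (p s) + (𝟙 (t ≢ᵇ s ∧ p t) + count rest)
          ≤⟨ +-mono-≤ (𝟙≤1 (p s)) (+-monoˡ-≤ (count rest) (𝟙≤1 _)) ⟩
        2 + count rest                                           ∎))
      w≢ᵇt , w≢ᵇs∧pw = ∧-true {w ≢ᵇ t} pw′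
      w≢ᵇs , pw = ∧-true {w ≢ᵇ s} w≢ᵇs∧pw
  in w , pw , ≢ᵇ⇒≢ w≢ᵇs , ≢ᵇ⇒≢ w≢ᵇt
  where
  open ≤-Reasoning
  rest : Fin _ → Bool
  rest w = w ≢ᵇ t ∧ (w ≢ᵇ s ∧ p w)

other-vertex : 3 ≤ n → (s t : Fin n) → ∃ λ w → w ≢ s × w ≢ t
other-vertex {n} 3≤n s t =
  let w , _ , w≢s , w≢t = witness-avoiding (λ _ → true) (subst (3 ≤_) (sym (count-all n)) 3≤n) s t in w , w≢s , w≢t

handshake : (A : Fin n → Fin n → Bool) → (∀ u v → A u v ≡ A v u) → (∀ u → A u u ≡ false)
          → ∃ λ m → sum (λ v → count (A v)) ≡ 2 * m
handshake {zero}  A A-sym A-irrefl = 0 , refl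
handshake {suc n} A A-sym A-irrefl = c + m , (begin
  count (A zero) + sum (λ v → count (A (suc v)))
    ≡⟨ cong₂ _+_ (cong (λ b → 𝟙 b + c) (A-irrefl zero))
                 (∑-distrib-+ (λ v → 𝟙 (A (suc v) zero)) (λ v → count (λ w → A (suc v) (suc w)))) ⟩
  c + (sum (λ v → 𝟙 (A (suc v) zero)) + sum (λ v → count (λ w → A (suc v) (suc w))))
    ≡⟨ cong₂ (λ a b → c + (a + b)) (sum-cong-≗ λ v → cong 𝟙 (A-sym (suc v) zero)) m-sum ⟩
  c + (c + 2 * m)
    ≡⟨ double c m ⟩
  2 * (c + m) ∎)
  where
  open ≡-Reasoning
  c : ℕ
  c = count (λ w → A zero (suc w))
  rest : ∃ λ m → sum (λ v → count (λ w → A (suc v) (suc w))) ≡ 2 * m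
  rest = handshake (λ v w → A (suc v) (suc w)) (λ v w → A-sym (suc v) (suc w)) (λ v → A-irrefl (suc v))
  m : ℕ
  m = proj₁ rest
  m-sum : sum (λ v → count (λ w → A (suc v) (suc w))) ≡ 2 * m
  m-sum = proj₂ rest
  double : ∀ c m → c + (c + 2 * m) ≡ 2 * (c + m)
  double = solve-∀

listSum-tabulate : (f : Fin n → ℕ) → ListSum (tabulate f) ≡ sum f
listSum-tabulate {zero}  f = refl
listSum-tabulate {suc n} f = cong (f zero +_) (listSum-tabulate (λ w → f (suc w)))

degree≡count : (K : Graph n) (u : Fin n) → degree K u ≡ count (adj K u)
degree≡count {n} K u =
  trans (cong ListSum (map-tabulate (λ w → w) (λ w → 𝟙 (adj K u w)))) (listSum-tabulate (λ w → 𝟙 (adj K u w)))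

-- Cards

inCard : Fin n → Fin n → Fin n → Bool
inCard x y w = w ≢ᵇ x ∧ w ≢ᵇ y

inCard-x : (x y : Fin n) → inCard x y x ≡ false
inCard-x x y rewrite ≢ᵇ-refl x = refl

inCard-y : (x y : Fin n) → inCard x y y ≡ false
inCard-y x y rewrite ≢ᵇ-refl y = ∧-zeroʳ (y ≢ᵇ x)

inCard-Del : {x y : Fin n} (u : Del n x y) → inCard x y (proj₁ u) ≡ true
inCard-Del u = Equivalence.to T-≡ (proj₂ u)

Del-≡ : {x y : Fin n} {u v : Del n x y} → proj₁ u ≡ proj₁ v → u ≡ v
Del-≡ {u = w , s} {v = .w , t} refl = cong (w ,_) (T-irrelevant s t)

Del-≢ : {x y : Fin n} (u : Del n x y) → proj₁ u ≢ x × proj₁ u ≢ y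
Del-≢ u = let w≢ᵇx , w≢ᵇy = ∧-true (inCard-Del u) in ≢ᵇ⇒≢ w≢ᵇx , ≢ᵇ⇒≢ w≢ᵇy

inCard-≢ : {x y w : Fin n} → w ≢ x → w ≢ y → inCard x y w ≡ true
inCard-≢ w≢x w≢y = cong₂ _∧_ (≢⇒≢ᵇ w≢x) (≢⇒≢ᵇ w≢y)

card-vertex : {x y w : Fin n} → w ≢ x → w ≢ y → Del n x y
card-vertex {w = w} w≢x w≢y = w , Equivalence.from T-≡ (inCard-≢ w≢x w≢y)

card-image-≢ : {x y x' y' : Fin n} (φ : Del n x y ↔ Del n x' y') {u v : Del n x y}
             → proj₁ u ≢ proj₁ v → proj₁ (Inverse.to φ u) ≢ proj₁ (Inverse.to φ v)
card-image-≢ φ u≢v image≡ = u≢v (cong proj₁ (Injection.injective (↔⇒↣ φ) (Del-≡ image≡)))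

data Position {n} (x y : Fin n) : Fin n → Set where
  at-x    : Position x y x
  at-y    : Position x y y
  in-card : (u : Del n x y) → Position x y (proj₁ u)

position : (x y w : Fin n) → Position x y w
position x y w with w ≟ x | w ≟ y
... | yes refl | _        = at-x
... | no _     | yes refl = at-y
... | no w≢x   | no w≢y   = in-card (card-vertex w≢x w≢y)

extend : {x y x' y' : Fin n} → (Del n x y → Del n x' y') → Fin n → Fin n
extend {x = x} {y} {x'} {y'} f w with w ≟ x | w ≟ y
... | yes _  | _      = x'
... | no _   | yes _  = y'
... | no w≢x | no w≢y = proj₁ (f (card-vertex w≢x w≢y))

module _ {x y x' y' : Fin n} (f : Del n x y → Del n x' y') where

  extend-x : extend f x ≡ x'
  extend-x with x ≟ x
  ... | yes _  = refl
  ... | no x≢x = ⊥-elim (x≢x refl)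

  extend-y : x ≢ y → extend f y ≡ y'
  extend-y x≢y with y ≟ x | y ≟ y
  ... | yes y≡x | _      = ⊥-elim (x≢y (sym y≡x))
  ... | no _    | yes _  = refl
  ... | no _    | no y≢y = ⊥-elim (y≢y refl)

  extend-card : (u : Del n x y) → extend f (proj₁ u) ≡ proj₁ (f u)
  extend-card u with proj₁ u ≟ x | proj₁ u ≟ y
  ... | yes w≡x | _       = ⊥-elim (proj₁ (Del-≢ u) w≡x)
  ... | no _    | yes w≡y = ⊥-elim (proj₂ (Del-≢ u) w≡y)
  ... | no _    | no _    = cong (λ v → proj₁ (f v)) (Del-≡ refl)

extend-↔ : {x y x' y' : Fin n} → x ≢ y → x' ≢ y' → Del n x y ↔ Del n x' y' → Fin n ↔ Fin n
extend-↔ {x = x} {y} {x'} {y'} x≢y x'≢y' φ =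
  mk↔ₛ′ (extend to) (extend from) extend-inverse extend-inverse′
  where
  open Inverse φ
  extend-inverse : ∀ w → extend to (extend from w) ≡ w
  extend-inverse w with position x' y' w
  ... | at-x      = trans (cong (extend to) (extend-x from)) (extend-x to)
  ... | at-y      = trans (cong (extend to) (extend-y from x'≢y')) (extend-y to x≢y)
  ... | in-card u = trans (cong (extend to) (extend-card from u))
                          (trans (extend-card to (from u)) (cong proj₁ (strictlyInverseˡ u)))
  extend-inverse′ : ∀ w → extend from (extend to w) ≡ w
  extend-inverse′ w with position x y w
  ... | at-x      = trans (cong (extend from) (extend-x to)) (extend-x from)
  ... | at-y      = trans (cong (extend from) (extend-y to x≢y)) (extend-y from x'≢y')
  ... | in-card u = trans (cong (extend from) (extend-card to u))
                          (trans (extend-card from (to u)) (cong proj₁ (strictlyInverseʳ u)))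

cardSum : Fin n → Fin n → (Fin n → ℕ) → ℕ
cardSum x y f = sum (λ w → if inCard x y w then f w else 0)

cardSum-cong : (x y : Fin n) {f g : Fin n → ℕ} → (∀ w → f w ≡ g w) → cardSum x y f ≡ cardSum x y g
cardSum-cong x y f≗g = sum-cong-≗ λ w → cong (λ m → if inCard x y w then m else 0) (f≗g w)

cardSum-+ : (x y : Fin n) (f g : Fin n → ℕ) → cardSum x y (λ w → f w + g w) ≡ cardSum x y f + cardSum x y g
cardSum-+ x y f g = trans (sum-cong-≗ λ w → if-+ (inCard x y w))
  (∑-distrib-+ (λ w → if inCard x y w then f w else 0) (λ w → if inCard x y w then g w else 0))
  where
  if-+ : ∀ {w} b → (if b then f w + g w else 0) ≡ (if b then f w else 0) + (if b then g w else 0)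
  if-+ true  = refl
  if-+ false = refl

-- The extension of φ is a permutation of the vertices, by which the sum is reindexed.
cardSum-↔ : {x y x' y' : Fin n} (x≢y : x ≢ y) (x'≢y' : x' ≢ y') (φ : Del n x y ↔ Del n x' y')
          → {f g : Fin n → ℕ} → (∀ u → f (proj₁ u) ≡ g (proj₁ (Inverse.to φ u)))
          → cardSum x y f ≡ cardSum x' y' g
cardSum-↔ {n} {x = x} {y} {x'} {y'} x≢y x'≢y' φ {f} {g} f≡g = begin
  cardSum x y f                                      ≡⟨ sum-cong-≗ summand ⟩
  sum (λ w → restrict (Inverse.to Θ w))              ≡⟨ sum-permute restrict Θ ⟨
  cardSum x' y' g                                    ∎
  where
  open ≡-Reasoning
  open Inverse φ
  Θ = extend-↔ x≢y x'≢y' φ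
  restrict : Fin n → ℕ
  restrict v = if inCard x' y' v then g v else 0
  summand : ∀ w → (if inCard x y w then f w else 0) ≡ restrict (extend to w)
  summand w with position x y w
  ... | at-x      rewrite extend-x to | inCard-x x y | inCard-x x' y' = refl
  ... | at-y      rewrite extend-y to x≢y | inCard-y x y | inCard-y x' y' = refl
  ... | in-card u rewrite extend-card to u | inCard-Del u | inCard-Del (to u) = f≡g u

sum-card-split : {x y : Fin n} → x ≢ y → (f : Fin n → ℕ) → sum f ≡ f x + f y + cardSum x y f
sum-card-split {x = x} {y} x≢y f = begin
  sum f
    ≡⟨ sum-split x f ⟩
  f x + sum (λ w → if w ≢ᵇ x then f w else 0)
    ≡⟨ cong (f x +_) (sum-split y _) ⟩
  f x + ((if y ≢ᵇ x then f y else 0) + sum (λ w → if w ≢ᵇ y then (if w ≢ᵇ x then f w else 0) else 0))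
    ≡⟨ cong₂ (λ a b → f x + (a + b)) (cong (if_then f y else 0) (≢⇒≢ᵇ (≢-sym x≢y)))
                                     (sum-cong-≗ λ w → if-if (w ≢ᵇ x) (w ≢ᵇ y) (f w)) ⟩
  f x + (f y + cardSum x y f)
    ≡⟨ +-assoc (f x) (f y) _ ⟨
  f x + f y + cardSum x y f ∎
  where
  open ≡-Reasoning
  if-if : ∀ a b m → (if b then (if a then m else 0) else 0) ≡ (if a ∧ b then m else 0)
  if-if true  true  m = refl
  if-if true  false m = refl
  if-if false true  m = refl
  if-if false false m = refl

cardDegree : Graph n → Fin n → Fin n → Fin n → ℕ
cardDegree K x y u = cardSum x y (λ w → 𝟙 (adj K u w))

deficit : Graph n → Fin n → Fin n → Fin n → ℕ
deficit K x y u = 𝟙 (adj K u x) + 𝟙 (adj K u y)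

degree-split : (K : Graph n) {x y : Fin n} → x ≢ y → (u : Fin n)
             → degree K u ≡ deficit K x y u + cardDegree K x y u
degree-split K x≢y u = trans (degree≡count K u) (sum-card-split x≢y (λ w → 𝟙 (adj K u w)))

deleted-cardDegrees≡deficits : (K : Graph n) (x y : Fin n)
                             → cardDegree K x y x + cardDegree K x y y ≡ cardSum x y (deficit K x y)
deleted-cardDegrees≡deficits K x y = trans (sym (cardSum-+ x y (λ w → 𝟙 (adj K x w)) (λ w → 𝟙 (adj K y w))))
  (cardSum-cong x y λ w → cong₂ _+_ (cong 𝟙 (adj-sym K x w)) (cong 𝟙 (adj-sym K y w)))

cardDegree-iso : (K L : Graph n) {x y x' y' : Fin n} → x ≢ y → x' ≢ y'
               → (ψ : DelIso K x y L x' y') (u : Del n x y)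
               → cardDegree K x y (proj₁ u) ≡ cardDegree L x' y' (proj₁ (Inverse.to (proj₁ ψ) u))
cardDegree-iso K L x≢y x'≢y' (φ , adj≡) u = cardSum-↔ x≢y x'≢y' φ (λ v → cong 𝟙 (adj≡ u v))

Del-swap : {x y : Fin n} → Del n x y ↔ Del n y x
Del-swap = mk↔ₛ′ swap swap (λ u → Del-≡ refl) (λ u → Del-≡ refl)
  where
  swap : {x y : Fin _} → Del _ x y → Del _ y x
  swap u = card-vertex (proj₂ (Del-≢ u)) (proj₁ (Del-≢ u))

module _ {K L : Graph n} {x y x' y' : Fin n} where

  DelIso-sym : DelIso K x y L x' y' → DelIso L x' y' K x y
  DelIso-sym (φ , adj≡) = ↔-sym φ , λ u v → sym (begin
    adj K (proj₁ (from u)) (proj₁ (from v))              ≡⟨ adj≡ (from u) (from v) ⟩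
    adj L (proj₁ (to (from u))) (proj₁ (to (from v)))    ≡⟨ cong₂ (λ a b → adj L (proj₁ a) (proj₁ b))
                                                                  (strictlyInverseˡ u) (strictlyInverseˡ v) ⟩
    adj L (proj₁ u) (proj₁ v)                            ∎)
    where
    open Inverse φ
    open ≡-Reasoning

  DelIso-swapʳ : DelIso K x y L x' y' → DelIso K x y L y' x'
  DelIso-swapʳ (φ , adj≡) = ↔-trans φ Del-swap , adj≡

  DelIso-swapˡ : DelIso K x y L x' y' → DelIso K y x L x' y'
  DelIso-swapˡ (φ , adj≡) = ↔-trans Del-swap φ , λ u v → adj≡ (Inverse.to Del-swap u) (Inverse.to Del-swap v)

DelIso-trans : {K L M : Graph n} {x y x' y' x'' y'' : Fin n}
             → DelIso K x y L x' y' → DelIso L x' y' M x'' y'' → DelIso K x y M x'' y''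
DelIso-trans (φ , adj≡) (χ , adj≡′) =
  ↔-trans φ χ , λ u v → trans (adj≡ u v) (adj≡′ (Inverse.to φ u) (Inverse.to φ v))

≅-sym : {K L : Graph n} → K ≅ L → L ≅ K
≅-sym {L = L} (φ , adj≡) = ↔-sym φ , λ u v →
  sym (trans (adj≡ (from u) (from v)) (cong₂ (adj L) (strictlyInverseˡ u) (strictlyInverseˡ v)))
  where open Inverse φ

≅-trans : {K L M : Graph n} → K ≅ L → L ≅ M → K ≅ M
≅-trans (φ , adj≡) (χ , adj≡′) =
  ↔-trans φ χ , λ u v → trans (adj≡ u v) (adj≡′ (Inverse.to φ u) (Inverse.to φ v))

SameDeck-sym : {K L : Graph n} → SameDeck K L → SameDeck L K
SameDeck-sym {K = K} {L} (σ , cards) = ↔-sym σ , λ q →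
  subst (λ q′ → DelIso L (proj₁ (proj₁ q′)) (proj₂ (proj₁ q′)) K (proj₁ (proj₁ (from q))) (proj₂ (proj₁ (from q))))
        (strictlyInverseˡ q) (DelIso-sym {K = K} {L} (cards (from q)))
  where open Inverse σ

SameDeck-trans : {K L M : Graph n} → SameDeck K L → SameDeck L M → SameDeck K M
SameDeck-trans {K = K} {L} {M} (σ , cards) (τ , cards′) =
  ↔-trans σ τ , λ p → DelIso-trans {K = K} {L} {M} (cards p) (cards′ (Inverse.to σ p))

Pair-≢ : (p : Pair n) → proj₁ (proj₁ p) ≢ proj₂ (proj₁ p)
Pair-≢ (_ , x<y) = <⇒≢ (toWitness x<y)

matching-card : (K L : Graph n) → SameDeck K L → {x y : Fin n} → x ≢ y
              → Σ (Fin n) λ x' → Σ (Fin n) λ y' → x' ≢ y' × DelIso K x y L x' y'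
matching-card K L (σ , cards) {x} {y} x≢y with <-cmp x y
... | tri< x<y _ _ = let q = Inverse.to σ ((x , y) , fromWitness x<y) in
  proj₁ (proj₁ q) , proj₂ (proj₁ q) , Pair-≢ q , cards ((x , y) , fromWitness x<y)
... | tri≈ _ x≡y _ = ⊥-elim (x≢y x≡y)
... | tri> _ _ y<x = let q = Inverse.to σ ((y , x) , fromWitness y<x) in
  proj₁ (proj₁ q) , proj₂ (proj₁ q) , Pair-≢ q , DelIso-swapˡ {K = K} {L} (cards ((y , x) , fromWitness y<x))

-- Degrees

adjacent-≢ : (K : Graph n) {u w : Fin n} → adj K u w ≡ true → u ≢ w
adjacent-≢ K {u} u~w refl with () ← trans (sym u~w) (adj-irrefl K u)

cubic-count : (K : Graph n) → Regular 3 K → (v : Fin n) → count (adj K v) ≡ 3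
cubic-count K cubic v = trans (sym (degree≡count K v)) (cubic v)

deficit≤2 : (K : Graph n) (x y u : Fin n) → deficit K x y u ≤ 2
deficit≤2 K x y u = +-mono-≤ (𝟙≤1 (adj K u x)) (𝟙≤1 (adj K u y))

cubic-split : (K : Graph n) → Regular 3 K → {x y : Fin n} → x ≢ y → (u : Fin n)
            → deficit K x y u + cardDegree K x y u ≡ 3
cubic-split K cubic x≢y u = trans (sym (degree-split K x≢y u)) (cubic u)

deleted-cardDegrees-cubic : (K : Graph n) → Regular 3 K → {x y : Fin n} → x ≢ y
                          → 𝟙 (adj K x y) + 𝟙 (adj K x y) + (cardDegree K x y x + cardDegree K x y y) ≡ 6
deleted-cardDegrees-cubic K cubic {x} {y} x≢y = begin
  𝟙 (adj K x y) + 𝟙 (adj K x y) + (cardDegree K x y x + cardDegree K x y y)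
    ≡⟨ interchange (𝟙 (adj K x y)) (𝟙 (adj K x y)) (cardDegree K x y x) (cardDegree K x y y) ⟩
  (𝟙 (adj K x y) + cardDegree K x y x) + (𝟙 (adj K x y) + cardDegree K x y y)
    ≡⟨ cong₂ _+_ (cong (λ b → 𝟙 b + 𝟙 (adj K x y) + cardDegree K x y x) (sym (adj-irrefl K x)))
                 (trans (cong (_+ cardDegree K x y y) (sym (+-identityʳ (𝟙 (adj K x y)))))
                        (cong₂ (λ b c → 𝟙 b + 𝟙 c + cardDegree K x y y) (adj-sym K x y) (sym (adj-irrefl K y)))) ⟩
  (deficit K x y x + cardDegree K x y x) + (deficit K x y y + cardDegree K x y y)
    ≡⟨ cong₂ _+_ (cubic-split K cubic x≢y x) (cubic-split K cubic x≢y y) ⟩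
  6 ∎
  where open ≡-Reasoning

no-fourth-neighbour : (K : Graph n) → Regular 3 K → {v a b c w : Fin n} → Unique (a ∷ b ∷ c ∷ [])
                    → adj K v a ≡ true → adj K v b ≡ true → adj K v c ≡ true
                    → w ≢ a → w ≢ b → w ≢ c → adj K v w ≡ false
no-fourth-neighbour K cubic {v} {w = w} ((a≢b ∷ a≢c ∷ []) ∷ (b≢c ∷ []) ∷ [] ∷ []) v~a v~b v~c w≢a w≢b w≢c
  with adj K v w in v~w
... | false = refl
... | true  = ⊥-elim (1+n≰n (≤-trans
  (count-≥-length (unique₄ a≢b a≢c (≢-sym w≢a) b≢c (≢-sym w≢b) (≢-sym w≢c)) (v~a ∷ v~b ∷ v~c ∷ v~w ∷ []))
  (≤-reflexive (cubic-count K cubic v))))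

cardDegree-count : (K : Graph n) (x y u : Fin n) → cardDegree K x y u ≡ count (λ w → inCard x y w ∧ adj K u w)
cardDegree-count K x y u = sum-cong-≗ λ w → sym (𝟙-∧ (inCard x y w) (adj K u w))

non-adjacent : Graph n → Fin n → Fin n → Bool
non-adjacent K u w = w ≢ᵇ u ∧ not (adj K u w)

degree+non-adjacent : (K : Graph n) (u : Fin n) → degree K u + suc (count (non-adjacent K u)) ≡ n
degree+non-adjacent K u = begin
  degree K u + suc (count (non-adjacent K u))
    ≡⟨ cong₂ (λ d b → d + (𝟙 (not b) + count (non-adjacent K u))) (degree≡count K u) (sym (adj-irrefl K u)) ⟩
  count (adj K u) + (𝟙 (not (adj K u u)) + count (non-adjacent K u))
    ≡⟨ cong (count (adj K u) +_) (count-split u (λ w → not (adj K u w))) ⟨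
  count (adj K u) + count (λ w → not (adj K u w))
    ≡⟨ count-compl (adj K u) ⟩
  _ ∎
  where open ≡-Reasoning

degree<order : (K : Graph n) (u : Fin n) → degree K u < n
degree<order K u = ≤-trans (m<m+n (degree K u) (s≤s z≤n)) (≤-reflexive (degree+non-adjacent K u))

order≥4 : (K : Graph n) → Regular 3 K → Fin n → 4 ≤ n
order≥4 K cubic v = subst (_< _) (cubic v) (degree<order K v)

cubic-order-even : (K : Graph n) → Regular 3 K → ∃ λ m → sum {n} (λ _ → 3) ≡ 2 * m
cubic-order-even K cubic =
  let m , even = handshake (adj K) (adj-sym K) (adj-irrefl K)
  in m , trans (sum-cong-≗ λ v → sym (cubic-count K cubic v)) even

-- Reconstructions of a cubic graph are cubic

module Reconstruction (G R : Graph n) (G-cubic : Regular 3 G) (deck : SameDeck R G) where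

  cardDegree-bounds : {a b : Fin n} → a ≢ b → (u : Del n a b)
                    → 1 ≤ cardDegree R a b (proj₁ u) × cardDegree R a b (proj₁ u) ≤ 3
  cardDegree-bounds a≢b u with matching-card R G deck a≢b
  ... | x , y , x≢y , ψ rewrite cardDegree-iso R G a≢b x≢y ψ u =
    +-cancelˡ-≤ 2 1 _ (≤-trans (≤-reflexive (sym split)) (+-monoˡ-≤ _ (deficit≤2 G x y v))) ,
    ≤-trans (m≤n+m _ _) (≤-reflexive split)
    where
    v = proj₁ (Inverse.to (proj₁ ψ) u)
    split = cubic-split G G-cubic x≢y v

  degree-bounds : {a b u : Fin n} → a ≢ b → u ≢ a → u ≢ b
                → deficit R a b u + 1 ≤ degree R u × degree R u ≤ deficit R a b u + 3
  degree-bounds {a} {b} {u} a≢b u≢a u≢b rewrite degree-split R a≢b u =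
    +-monoʳ-≤ _ (proj₁ bounds) , +-monoʳ-≤ _ (proj₂ bounds)
    where bounds = cardDegree-bounds a≢b (card-vertex u≢a u≢b)

  three≤degree : 3 ≤ n → (u : Fin n) → 3 ≤ degree R u
  three≤degree 3≤n u = d₃
    where
    d₁ : 1 ≤ degree R u
    d₁ = let a , a≢u , _ = other-vertex 3≤n u u
             b , b≢u , b≢a = other-vertex 3≤n u a
         in ≤-trans (m≤n+m 1 (deficit R a b u)) (proj₁ (degree-bounds (≢-sym b≢a) (≢-sym a≢u) (≢-sym b≢u)))
    d₂ : 2 ≤ degree R u
    d₂ = let a , u~a = count-witness (adj R u) (subst (1 ≤_) (degree≡count R u) d₁)
             b , b≢u , b≢a = other-vertex 3≤n u a
         in ≤-trans (+-monoˡ-≤ 1 (subst (λ c → 1 ≤ 𝟙 c + 𝟙 (adj R u b)) (sym u~a) (s≤s z≤n)))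
                    (proj₁ (degree-bounds (≢-sym b≢a) (adjacent-≢ R u~a) (≢-sym b≢u)))
    d₃ : 3 ≤ degree R u
    d₃ = let a , b , a≢b , u~a , u~b = count-witnesses₂ (adj R u) (subst (2 ≤_) (degree≡count R u) d₂) in
      subst (_≤ degree R u) (cong₂ (λ c d → 𝟙 c + 𝟙 d + 1) u~a u~b)
            (proj₁ (degree-bounds a≢b (adjacent-≢ R u~a) (adjacent-≢ R u~b)))

  degree≤5 : 3 ≤ n → (u : Fin n) → degree R u ≤ 5
  degree≤5 3≤n u =
    let a , a≢u , _ = other-vertex 3≤n u u
        b , b≢u , b≢a = other-vertex 3≤n u a
    in ≤-trans (proj₂ (degree-bounds (≢-sym b≢a) (≢-sym a≢u) (≢-sym b≢u))) (+-monoˡ-≤ 3 (deficit≤2 R a b u))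

  degree≤3 : 8 ≤ n → (u : Fin n) → degree R u ≤ 3
  degree≤3 8≤n u =
    let a , b , a≢b , a≁u , b≁u = count-witnesses₂ (non-adjacent R u) two-non-neighbours
        a≢ᵇu , ¬u~a = ∧-true a≁u
        b≢ᵇu , ¬u~b = ∧-true b≁u
    in subst (λ d → degree R u ≤ d + 3) (cong₂ (λ c d → 𝟙 c + 𝟙 d) (not-true ¬u~a) (not-true ¬u~b))
             (proj₂ (degree-bounds a≢b (≢-sym (≢ᵇ⇒≢ a≢ᵇu)) (≢-sym (≢ᵇ⇒≢ b≢ᵇu))))
    where
    two-non-neighbours : 2 ≤ count (non-adjacent R u)
    two-non-neighbours = +-cancelˡ-≤ 6 2 (count (non-adjacent R u)) (begin
      8                                            ≤⟨ 8≤n ⟩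
      n                                            ≡⟨ degree+non-adjacent R u ⟨
      degree R u + suc (count (non-adjacent R u))  ≤⟨ +-monoˡ-≤ (suc (count (non-adjacent R u)))
                                                                (degree≤5 (≤-trans (m≤m+n 3 5) 8≤n) u) ⟩
      6 + count (non-adjacent R u)                 ∎)
      where open ≤-Reasoning

forced-true : {p : Fin 6 → Bool} → count p ≡ 3 → {a b c d : Fin 6} → Unique (a ∷ b ∷ c ∷ d ∷ [])
       → p a ≡ false → p b ≡ false → p c ≡ false → p d ≡ true
forced-true {p} count≡3 {d = d} uniq pa pb pc with p d in pd
... | true  = refl
... | false = ⊥-elim (1+n≰n (subst (λ k → k + 4 ≤ 6) count≡3 (count-≤-avoiding uniq (pa ∷ pb ∷ pc ∷ pd ∷ []))))

cardDegree≥3⇒no-deficit : (K : Graph n) → Regular 3 K → {x y : Fin n} → x ≢ y → (w : Fin n)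
                 → 3 ≤ cardDegree K x y w
                 → adj K w x ≡ false × adj K w y ≡ false × count (λ z → inCard x y z ∧ adj K w z) ≡ 3
cardDegree≥3⇒no-deficit K cubic {x} {y} x≢y w full =
  𝟙≡0 (m+n≡0⇒m≡0 _ no-deficit) , 𝟙≡0 (m+n≡0⇒n≡0 (𝟙 (adj K w x)) no-deficit) ,
  trans (sym (cardDegree-count K x y w)) (subst (λ d → d + cardDegree K x y w ≡ 3) no-deficit split)
  where
  split = cubic-split K cubic x≢y w
  no-deficit : deficit K x y w ≡ 0
  no-deficit = n≤0⇒n≡0 (+-cancelʳ-≤ 3 (deficit K x y w) 0
                 (≤-trans (+-monoʳ-≤ (deficit K x y w) full) (≤-reflexive split)))
  𝟙≡0 : ∀ {b} → 𝟙 b ≡ 0 → b ≡ false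
  𝟙≡0 {false} _ = refl

outsiders : {p q r s : Fin 6} → Unique (p ∷ q ∷ r ∷ s ∷ [])
          → Σ (Fin 6) λ a → Σ (Fin 6) λ b → a ≢ b
            × (a ≢ p × a ≢ q × a ≢ r × a ≢ s) × (b ≢ p × b ≢ q × b ≢ r × b ≢ s)
outsiders {p} {q} {r} {s} uniq =
  let a , b , a≢b , a-out , b-out = count-witnesses₂ (outside ss) two-outside
  in a , b , a≢b , avoids (outside-≢ ss a-out) , avoids (outside-≢ ss b-out)
  where
  ss = p ∷ q ∷ r ∷ s ∷ []
  two-outside : 2 ≤ count (outside ss)
  two-outside = +-cancelʳ-≤ 4 2 (count (outside ss)) (≤-reflexive (sym (count-outside uniq)))
  avoids : ∀ {w} → All (w ≢_) ss → w ≢ p × w ≢ q × w ≢ r × w ≢ s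
  avoids (w≢p ∷ w≢q ∷ w≢r ∷ w≢s ∷ []) = w≢p , w≢q , w≢r , w≢s

-- w and w' miss x and y, which forces a vertex outside {x, y, w, w'} to be adjacent to all four.
at-most-one-cardDegree≥3 : (K : Graph 6) → Regular 3 K → {x y w w' : Fin 6}
                          → x ≢ y → w ≢ x → w ≢ y → w' ≢ x → w' ≢ y → w ≢ w'
                          → 3 ≤ cardDegree K x y w → 3 ≤ cardDegree K x y w' → ⊥
at-most-one-cardDegree≥3 K cubic {x} {y} {w} {w'} x≢y w≢x w≢y w'≢x w'≢y w≢w' full full′ =
  let c , _ , _ , (c≢x , c≢y , c≢w , c≢w') , _ = outsiders uniq in four-neighbours c≢x c≢y c≢w c≢w'
  where
  uniq = unique₄ x≢y (≢-sym w≢x) (≢-sym w'≢x) (≢-sym w≢y) (≢-sym w'≢y) w≢w'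
  w-full = cardDegree≥3⇒no-deficit K cubic x≢y w full
  w'-full = cardDegree≥3⇒no-deficit K cubic x≢y w' full′
  four-neighbours : ∀ {c} → c ≢ x → c ≢ y → c ≢ w → c ≢ w' → ⊥
  four-neighbours {c} c≢x c≢y c≢w c≢w' =
    1+n≰n (≤-trans (count-≥-length uniq (c~x ∷ c~y ∷ c~w ∷ c~w' ∷ [])) (≤-reflexive (cubic-count K cubic c)))
    where
    deleted-neighbour : ∀ {v} → v ≢ w → v ≢ w' → v ≢ c → adj K v w ≡ false → adj K v w' ≡ false → adj K v c ≡ true
    deleted-neighbour {v} v≢w v≢w' v≢c v≁w v≁w' =
      forced-true (cubic-count K cubic v) (unique₄ v≢w v≢w' v≢c w≢w' (≢-sym c≢w) (≢-sym c≢w'))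
             (adj-irrefl K v) v≁w v≁w'
    card-neighbour : ∀ {v} → v ≢ x → v ≢ y → v ≢ c → count (λ z → inCard x y z ∧ adj K v z) ≡ 3 → adj K v c ≡ true
    card-neighbour {v} v≢x v≢y v≢c count≡3 = proj₂ (∧-true (forced-true {λ z → inCard x y z ∧ adj K v z} count≡3
      (unique₄ x≢y (≢-sym v≢x) (≢-sym c≢x) (≢-sym v≢y) (≢-sym c≢y) v≢c)
      (cong (_∧ adj K v x) (inCard-x x y)) (cong (_∧ adj K v y) (inCard-y x y))
      (trans (cong (inCard x y v ∧_) (adj-irrefl K v)) (∧-zeroʳ (inCard x y v)))))
    c~x = trans (adj-sym K c x) (deleted-neighbour (≢-sym w≢x) (≢-sym w'≢x) (≢-sym c≢x)
            (trans (adj-sym K x w) (proj₁ w-full)) (trans (adj-sym K x w') (proj₁ w'-full)))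
    c~y = trans (adj-sym K c y) (deleted-neighbour (≢-sym w≢y) (≢-sym w'≢y) (≢-sym c≢y)
            (trans (adj-sym K y w) (proj₁ (proj₂ w-full))) (trans (adj-sym K y w') (proj₁ (proj₂ w'-full))))
    c~w = trans (adj-sym K c w) (card-neighbour w≢x w≢y (≢-sym c≢w) (proj₂ (proj₂ w-full)))
    c~w' = trans (adj-sym K c w') (card-neighbour w'≢x w'≢y (≢-sym c≢w') (proj₂ (proj₂ w'-full)))

record Diamond (K : Graph n) : Set where
  constructor diamond
  field
    p q r s : Fin n
    r≢s     : r ≢ s
    p~q     : adj K p q ≡ true
    p~r     : adj K p r ≡ true
    p~s     : adj K p s ≡ true
    q~r     : adj K q r ≡ true
    q~s     : adj K q s ≡ true

module SixVertices (G R : Graph 6) (G-cubic : Regular 3 G) (deck : SameDeck R G) where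
  open Reconstruction G R G-cubic deck

  -- The card obtained by deleting the two vertices outside the diamond has two vertices of card degree 3.
  no-diamond : Diamond R → ⊥
  no-diamond (diamond p q r s r≢s p~q p~r p~s q~r q~s) =
    let a , b , a≢b , a-outside , b-outside = outsiders (unique₄ p≢q p≢r p≢s q≢r q≢s r≢s)
    in two-full-vertices a≢b a-outside b-outside
    where
    p≢q = adjacent-≢ R p~q
    p≢r = adjacent-≢ R p~r
    p≢s = adjacent-≢ R p~s
    q≢r = adjacent-≢ R q~r
    q≢s = adjacent-≢ R q~s
    two-full-vertices : ∀ {a b} → a ≢ b → a ≢ p × a ≢ q × a ≢ r × a ≢ s → b ≢ p × b ≢ q × b ≢ r × b ≢ s → ⊥
    two-full-vertices {a} {b} a≢b (a≢p , a≢q , a≢r , a≢s) (b≢p , b≢q , b≢r , b≢s) =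
      let x , y , x≢y , ψ = matching-card R G deck a≢b
          P′ = Inverse.to (proj₁ ψ) P
          Q′ = Inverse.to (proj₁ ψ) Q
      in at-most-one-cardDegree≥3 G G-cubic x≢y (proj₁ (Del-≢ P′)) (proj₂ (Del-≢ P′))
           (proj₁ (Del-≢ Q′)) (proj₂ (Del-≢ Q′)) (card-image-≢ (proj₁ ψ) p≢q)
           (subst (3 ≤_) (cardDegree-iso R G a≢b x≢y ψ P)
                  (full (unique₃ q≢r q≢s r≢s) (neighbour-in-card a≢q b≢q p~q)
                        (neighbour-in-card a≢r b≢r p~r) (neighbour-in-card a≢s b≢s p~s)))
           (subst (3 ≤_) (cardDegree-iso R G a≢b x≢y ψ Q)
                  (full (unique₃ p≢r p≢s r≢s) (neighbour-in-card a≢p b≢p (trans (adj-sym R q p) p~q))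
                        (neighbour-in-card a≢r b≢r q~r) (neighbour-in-card a≢s b≢s q~s)))
      where
      P = card-vertex (≢-sym a≢p) (≢-sym b≢p)
      Q = card-vertex (≢-sym a≢q) (≢-sym b≢q)
      full : ∀ {v c d e} → Unique (c ∷ d ∷ e ∷ [])
           → inCard a b c ∧ adj R v c ≡ true → inCard a b d ∧ adj R v d ≡ true → inCard a b e ∧ adj R v e ≡ true
           → 3 ≤ cardDegree R a b v
      full {v} uniq c∈ d∈ e∈ = subst (3 ≤_) (sym (cardDegree-count R a b v)) (count-≥-length uniq (c∈ ∷ d∈ ∷ e∈ ∷ []))
      neighbour-in-card : ∀ {v z} → a ≢ z → b ≢ z → adj R v z ≡ true → inCard a b z ∧ adj R v z ≡ true
      neighbour-in-card a≢z b≢z = cong₂ _∧_ (inCard-≢ (≢-sym a≢z) (≢-sym b≢z))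

  Escape : Fin 6 → Fin 6 → Set
  Escape u v = (∃ λ t → adj R v t ≡ true × non-adjacent R u t ≡ true) × (∃ λ w → adj R v w ≡ true × adj R u w ≡ true)

  module _ {u v : Fin 6} (one-non-adjacent : count (non-adjacent R u) ≤ 1) (u~v : adj R u v ≡ true) where

    private
      others common excess : Fin 6 → Bool
      others w = w ≢ᵇ u ∧ adj R v w
      common w = others w ∧ adj R u w
      excess w = others w ∧ not (adj R u w)

      two-others : 2 ≤ count common + count excess
      two-others = begin
        2                            ≤⟨ +-cancelˡ-≤ 1 2 (count others) (begin
          3                            ≤⟨ three≤degree (m≤m+n 3 3) v ⟩
          degree R v                   ≡⟨ degree≡count R v ⟩
          count (adj R v)              ≡⟨ count-split u (adj R v) ⟩
          𝟙 (adj R v u) + count others ≡⟨ cong (λ b → 𝟙 b + count others) (trans (adj-sym R v u) u~v) ⟩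
          1 + count others             ∎) ⟩
        count others                 ≡⟨ count-partition others (adj R u) ⟩
        count common + count excess  ∎
        where open ≤-Reasoning

      excess⇒non-adjacent : ∀ {w} → excess w ≡ true → non-adjacent R u w ≡ true
      excess⇒non-adjacent {w} ex =
        let other , u≁w = ∧-true {others w} ex in cong₂ _∧_ (proj₁ (∧-true {w ≢ᵇ u} other)) u≁w

      count-excess≤1 : count excess ≤ 1
      count-excess≤1 = ≤-trans (count-mono (λ w → excess⇒non-adjacent {w})) one-non-adjacent

    neighbour-step : Diamond R ⊎ Escape u v
    neighbour-step with 2 ≤? count common
    ... | yes two =
      let w , w' , w≢w' , common-w , common-w' = count-witnesses₂ common two
          other-w , u~w = ∧-true common-w
          other-w' , u~w' = ∧-true common-w'
      in inj₁ (diamond u v w w' w≢w' u~v u~w u~w' (proj₂ (∧-true other-w)) (proj₂ (∧-true other-w')))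
    ... | no ¬two =
      let count-common≤1 = ≤-pred (≰⇒> ¬two)
          t , excess-t = count-witness excess (+-cancelˡ-≤ 1 1 (count excess)
                           (≤-trans two-others (+-monoˡ-≤ (count excess) count-common≤1)))
          w , common-w = count-witness common (+-cancelʳ-≤ 1 1 (count common)
                           (≤-trans two-others (+-monoʳ-≤ (count common) count-excess≤1)))
          other-w , u~w = ∧-true {others w} common-w
      in inj₂ ((t , proj₂ (∧-true {t ≢ᵇ u} (proj₁ (∧-true {others t} excess-t))) , excess⇒non-adjacent excess-t) ,
               (w , proj₂ (∧-true {w ≢ᵇ u} other-w) , u~w))

  non-adjacent≤1 : (u : Fin 6) → 4 ≤ degree R u → count (non-adjacent R u) ≤ 1
  non-adjacent≤1 u 4≤deg = +-cancelˡ-≤ 5 (count (non-adjacent R u)) 1 (begin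
    5 + count (non-adjacent R u)                ≤⟨ +-monoˡ-≤ (suc (count (non-adjacent R u))) 4≤deg ⟩
    degree R u + suc (count (non-adjacent R u)) ≡⟨ degree+non-adjacent R u ⟩
    6                                          ∎)
    where open ≤-Reasoning

  -- u misses at most one vertex t. A neighbour v of u has two neighbours in N(u), or one neighbour
  -- w ∈ N(u) and the neighbour t; if the same happens for w, then v w u t is a diamond.
  diamond-at : (u : Fin 6) → 4 ≤ degree R u → Diamond R
  diamond-at u 4≤deg =
    let v , u~v = count-witness (adj R u) (≤-trans (s≤s z≤n) (subst (4 ≤_) (degree≡count R u) 4≤deg))
    in after-step u~v (neighbour-step one-non-adjacent u~v)
    where
    one-non-adjacent = non-adjacent≤1 u 4≤deg
    after-step : ∀ {v} → adj R u v ≡ true → Diamond R ⊎ Escape u v → Diamond R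
    after-step _ (inj₁ d) = d
    after-step {v} u~v (inj₂ ((t , v~t , t-non-adjacent) , (w , v~w , u~w))) =
      after-second-step (neighbour-step one-non-adjacent u~w)
      where
      after-second-step : Diamond R ⊎ Escape u w → Diamond R
      after-second-step (inj₁ d) = d
      after-second-step (inj₂ ((t′ , w~t′ , t′-non-adjacent) , _)) =
        diamond v w u t (≢-sym (≢ᵇ⇒≢ (proj₁ (∧-true {t ≢ᵇ u} t-non-adjacent)))) v~w
                (trans (adj-sym R v u) u~v) v~t (trans (adj-sym R w u) u~w)
                (subst (λ z → adj R w z ≡ true) (count≤1-unique one-non-adjacent t′-non-adjacent t-non-adjacent) w~t′)

  R-cubic : Regular 3 R
  R-cubic u with 4 ≤? degree R u
  ... | yes 4≤deg = ⊥-elim (no-diamond (diamond-at u 4≤deg))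
  ... | no 4≰deg  = ≤-antisym (≤-pred (≰⇒> 4≰deg)) (three≤degree (m≤m+n 3 3) u)

reconstruction-regular : (G R : Graph n) → Regular 3 G → SameDeck G R → Regular 3 R
reconstruction-regular {0} G R G-cubic deck ()
reconstruction-regular {1} G R G-cubic deck _ = ⊥-elim (<⇒≱ (order≥4 G G-cubic zero) (s≤s z≤n))
reconstruction-regular {2} G R G-cubic deck _ = ⊥-elim (<⇒≱ (order≥4 G G-cubic zero) (s≤s (s≤s z≤n)))
reconstruction-regular {3} G R G-cubic deck _ = ⊥-elim (<⇒≱ (order≥4 G G-cubic zero) ≤-refl)
reconstruction-regular {4} G R G-cubic deck u =
  ≤-antisym (≤-pred (degree<order R u)) (three≤degree (m≤m+n 3 1) u)
  where open Reconstruction G R G-cubic (SameDeck-sym {K = G} {R} deck)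
reconstruction-regular {5} G R G-cubic deck _ =
  let m , even = cubic-order-even G G-cubic in ⊥-elim (even≢odd m 7 (sym even))
reconstruction-regular {6} G R G-cubic deck = SixVertices.R-cubic G R G-cubic (SameDeck-sym {K = G} {R} deck)
reconstruction-regular {7} G R G-cubic deck _ =
  let m , even = cubic-order-even G G-cubic in ⊥-elim (even≢odd m 10 (sym even))
reconstruction-regular {suc (suc (suc (suc (suc (suc (suc (suc k)))))))} G R G-cubic deck u =
  ≤-antisym (degree≤3 (m≤m+n 8 k) u) (three≤degree (m≤m+n 3 (5 + k)) u)
  where open Reconstruction G R G-cubic (SameDeck-sym {K = G} {R} deck)

-- Card isomorphisms of cubic graphs

module CubicCards (K L : Graph n) (K-cubic : Regular 3 K) (L-cubic : Regular 3 L)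
                  {x y x' y' : Fin n} (x≢y : x ≢ y) (x'≢y' : x' ≢ y') (ψ : DelIso K x y L x' y') where

  open Inverse (proj₁ ψ) using (to)

  Θ : Fin n → Fin n
  Θ = extend to

  deficit-preserved : (u : Del n x y) → deficit K x y (proj₁ u) ≡ deficit L x' y' (proj₁ (to u))
  deficit-preserved u = +-cancelʳ-≡ (cardDegree K x y (proj₁ u)) _ _ (begin
    deficit K x y (proj₁ u) + cardDegree K x y (proj₁ u)        ≡⟨ cubic-split K K-cubic x≢y (proj₁ u) ⟩
    3                                                          ≡⟨ cubic-split L L-cubic x'≢y' (proj₁ (to u)) ⟨
    deficit L x' y' (proj₁ (to u)) + cardDegree L x' y' (proj₁ (to u))
      ≡⟨ cong (deficit L x' y' (proj₁ (to u)) +_) (cardDegree-iso K L x≢y x'≢y' ψ u) ⟨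
    deficit L x' y' (proj₁ (to u)) + cardDegree K x y (proj₁ u) ∎)
    where open ≡-Reasoning

  -- The card degrees of x and y add up to the total deficit of the card, and to 6 − 2·[x ~ y].
  adjacency-preserved : adj K x y ≡ adj L x' y'
  adjacency-preserved = 𝟙-double-injective (adj K x y) (adj L x' y')
    (+-cancelʳ-≡ (cardDegree K x y x + cardDegree K x y y) _ _ (begin
    𝟙 (adj K x y) + 𝟙 (adj K x y) + (cardDegree K x y x + cardDegree K x y y)
      ≡⟨ deleted-cardDegrees-cubic K K-cubic x≢y ⟩
    6
      ≡⟨ deleted-cardDegrees-cubic L L-cubic x'≢y' ⟨
    𝟙 (adj L x' y') + 𝟙 (adj L x' y') + (cardDegree L x' y' x' + cardDegree L x' y' y')
      ≡⟨ cong (𝟙 (adj L x' y') + 𝟙 (adj L x' y') +_) deleted-sums ⟨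
    𝟙 (adj L x' y') + 𝟙 (adj L x' y') + (cardDegree K x y x + cardDegree K x y y) ∎))
    where
    open ≡-Reasoning
    deleted-sums : cardDegree K x y x + cardDegree K x y y ≡ cardDegree L x' y' x' + cardDegree L x' y' y'
    deleted-sums = trans (deleted-cardDegrees≡deficits K x y)
      (trans (cardSum-↔ x≢y x'≢y' (proj₁ ψ) deficit-preserved) (sym (deleted-cardDegrees≡deficits L x' y')))

  common-neighbour-reflected : (u : Del n x y) → adj L (proj₁ (to u)) x' ≡ true → adj L (proj₁ (to u)) y' ≡ true
                             → adj K (proj₁ u) x ≡ true × adj K (proj₁ u) y ≡ true
  common-neighbour-reflected u u′~x' u′~y' =
    𝟙+𝟙≡2 (trans (deficit-preserved u) (cong₂ (λ b c → 𝟙 b + 𝟙 c) u′~x' u′~y'))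

  common-neighbour-preserved : (u : Del n x y) → adj K (proj₁ u) x ≡ true → adj K (proj₁ u) y ≡ true
                             → adj L (proj₁ (to u)) x' ≡ true × adj L (proj₁ (to u)) y' ≡ true
  common-neighbour-preserved u u~x u~y =
    𝟙+𝟙≡2 (trans (sym (deficit-preserved u)) (cong₂ (λ b c → 𝟙 b + 𝟙 c) u~x u~y))

  neighbour-preserved : (u : Del n x y) → adj K (proj₁ u) x ≡ true
                      → adj L (proj₁ (to u)) x' ≡ true ⊎ adj L (proj₁ (to u)) y' ≡ true
  neighbour-preserved u u~x =
    𝟙+𝟙≥1 (subst (1 ≤_) (deficit-preserved u) (≤-trans (≤-reflexive (cong 𝟙 (sym u~x))) (m≤m+n _ _)))

  Θ-injective : {a b : Fin n} → Θ a ≡ Θ b → a ≡ b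
  Θ-injective = Injection.injective (↔⇒↣ (extend-↔ x≢y x'≢y' (proj₁ ψ)))

  neighbour-image : {s : Fin n} → adj K x s ≡ true → s ≡ y ⊎ adj K y s ≡ true → adj L x' (Θ s) ≡ true
  neighbour-image x~y (inj₁ refl) rewrite extend-y to x≢y = trans (sym adjacency-preserved) x~y
  neighbour-image {s} x~s (inj₂ y~s) = subst (λ v → adj L x' v ≡ true) (sym (extend-card to u))
    (trans (adj-sym L x' _)
           (proj₁ (common-neighbour-preserved u (trans (adj-sym K s x) x~s) (trans (adj-sym K s y) y~s))))
    where u = card-vertex (≢-sym (adjacent-≢ K x~s)) (≢-sym (adjacent-≢ K y~s))

  -- Once Θ transfers the neighbourhood of x, preservation of deficits transfers that of y.
  module _ (x-transfer : ∀ w → adj K x w ≡ adj L x' (Θ w)) where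

    y-transfer : ∀ w → adj K y w ≡ adj L y' (Θ w)
    y-transfer w with position x y w
    ... | at-x rewrite extend-x to =
      trans (adj-sym K y x) (trans adjacency-preserved (adj-sym L x' y'))
    ... | at-y rewrite extend-y to x≢y = trans (adj-irrefl K y) (sym (adj-irrefl L y'))
    ... | in-card u rewrite extend-card to u =
      trans (adj-sym K y (proj₁ u)) (trans u~y≡ (adj-sym L (proj₁ (to u)) y'))
      where
      u~x≡ : adj K (proj₁ u) x ≡ adj L (proj₁ (to u)) x'
      u~x≡ = trans (adj-sym K (proj₁ u) x) (trans (x-transfer (proj₁ u))
                (trans (cong (adj L x') (extend-card to u)) (adj-sym L x' (proj₁ (to u)))))
      u~y≡ : adj K (proj₁ u) y ≡ adj L (proj₁ (to u)) y'
      u~y≡ = 𝟙-injective (+-cancelˡ-≡ (𝟙 (adj K (proj₁ u) x)) _ _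
               (trans (deficit-preserved u) (cong (λ b → 𝟙 b + 𝟙 (adj L (proj₁ (to u)) y')) (sym u~x≡))))

    ≅-from-x : K ≅ L
    ≅-from-x = extend-↔ x≢y x'≢y' (proj₁ ψ) , Θ-adj
      where
      Θ-adj : ∀ u v → adj K u v ≡ adj L (Θ u) (Θ v)
      Θ-adj u v with position x y u
      ... | at-x rewrite extend-x to = x-transfer v
      ... | at-y rewrite extend-y to x≢y = y-transfer v
      ... | in-card u′ with position x y v
      ...   | at-x rewrite extend-x to =
        trans (adj-sym K (proj₁ u′) x) (trans (x-transfer (proj₁ u′)) (adj-sym L x' (Θ (proj₁ u′))))
      ...   | at-y rewrite extend-y to x≢y =
        trans (adj-sym K (proj₁ u′) y) (trans (y-transfer (proj₁ u′)) (adj-sym L y' (Θ (proj₁ u′))))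
      ...   | in-card v′ rewrite extend-card to u′ | extend-card to v′ = proj₂ ψ u′ v′

  ≅-from-x-neighbours : {a b c : Fin n} → Unique (a ∷ b ∷ c ∷ [])
                      → adj K x a ≡ true → adj K x b ≡ true → adj K x c ≡ true
                      → adj L x' (Θ a) ≡ true → adj L x' (Θ b) ≡ true → adj L x' (Θ c) ≡ true → K ≅ L
  ≅-from-x-neighbours {a} {b} {c} uniq x~a x~b x~c x'~a x'~b x'~c = ≅-from-x x-transfer
    where
    Θ-≢ : {u v : Fin n} → u ≢ v → Θ u ≢ Θ v
    Θ-≢ u≢v Θu≡Θv = u≢v (Θ-injective Θu≡Θv)
    image-unique : Unique (a ∷ b ∷ c ∷ []) → Unique (Θ a ∷ Θ b ∷ Θ c ∷ [])
    image-unique ((a≢b ∷ a≢c ∷ []) ∷ (b≢c ∷ []) ∷ [] ∷ []) = unique₃ (Θ-≢ a≢b) (Θ-≢ a≢c) (Θ-≢ b≢c)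
    x-transfer : ∀ w → adj K x w ≡ adj L x' (Θ w)
    x-transfer w with w ≟ a | w ≟ b | w ≟ c
    ... | yes refl | _        | _        = trans x~a (sym x'~a)
    ... | no _     | yes refl | _        = trans x~b (sym x'~b)
    ... | no _     | no _     | yes refl = trans x~c (sym x'~c)
    ... | no w≢a   | no w≢b   | no w≢c   =
      trans (no-fourth-neighbour K K-cubic uniq x~a x~b x~c w≢a w≢b w≢c)
            (sym (no-fourth-neighbour L L-cubic (image-unique uniq) x'~a x'~b x'~c (Θ-≢ w≢a) (Θ-≢ w≢b) (Θ-≢ w≢c)))

-- Short cycles

-- A triangle x y t is recorded with s = y, a square x s y t with s and t the common neighbours of x and y.
record ShortCycle (K : Graph n) : Set where
  constructor short-cycle
  field
    x y s t : Fin n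
    x≢y     : x ≢ y
    s≢t     : s ≢ t
    x~s     : adj K x s ≡ true
    x~t     : adj K x t ≡ true
    y~t     : adj K y t ≡ true
    s≡y⊎y~s : s ≡ y ⊎ adj K y s ≡ true

short-cycle-of : (K : Graph n) {ℓ : ℕ} → 3 ≤ ℓ → ℓ < 5 → HasCycle K ℓ → ShortCycle K
short-cycle-of K {3} _ _ (f , f-injective , f~) =
  short-cycle (f 0F) (f 1F) (f 1F) (f 2F)
              (λ eq → case f-injective 0F 1F eq of λ ()) (λ eq → case f-injective 1F 2F eq of λ ())
              (f~ 0F) (trans (adj-sym K (f 0F) (f 2F)) (f~ 2F)) (f~ 1F) (inj₁ refl)
short-cycle-of K {4} _ _ (f , f-injective , f~) =
  short-cycle (f 0F) (f 2F) (f 1F) (f 3F)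
              (λ eq → case f-injective 0F 2F eq of λ ()) (λ eq → case f-injective 1F 3F eq of λ ())
              (f~ 0F) (trans (adj-sym K (f 0F) (f 3F)) (f~ 3F)) (f~ 2F)
              (inj₂ (trans (adj-sym K (f 2F) (f 1F)) (f~ 1F)))
short-cycle-of K {suc (suc (suc (suc (suc _))))} _ (s≤s (s≤s (s≤s (s≤s (s≤s ()))))) _
short-cycle-of K {1} (s≤s ()) _ _
short-cycle-of K {2} (s≤s (s≤s ())) _ _

short-cycle-≅ : (K L : Graph n) → Regular 3 K → Regular 3 L → SameDeck K L → ShortCycle K → K ≅ L
short-cycle-≅ K L K-cubic L-cubic deck (short-cycle x y s t x≢y s≢t x~s x~t y~t s≡y⊎y~s) =
  let x' , y' , x'≢y' , ψ = matching-card K L deck x≢y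
      a , x~a , a≢s , a≢t = witness-avoiding (adj K x) (≤-reflexive (sym (cubic-count K K-cubic x))) s t
  in orient x~a a≢s a≢t x'≢y' ψ
  where
  from-x : ∀ {a x' y'} → adj K x a ≡ true → a ≢ s → a ≢ t → (x'≢y' : x' ≢ y') (ψ : DelIso K x y L x' y')
         → adj L x' (CubicCards.Θ K L K-cubic L-cubic x≢y x'≢y' ψ a) ≡ true → K ≅ L
  from-x x~a a≢s a≢t x'≢y' ψ x'~a = ≅-from-x-neighbours (unique₃ s≢t (≢-sym a≢s) (≢-sym a≢t))
    x~s x~t x~a (neighbour-image x~s s≡y⊎y~s) (neighbour-image x~t (inj₂ y~t)) x'~a
    where open CubicCards K L K-cubic L-cubic x≢y x'≢y' ψ
  -- The third neighbour a of x has deficit at least 1, so its image is adjacent to x' or to y'.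
  orient : ∀ {a x' y'} → adj K x a ≡ true → a ≢ s → a ≢ t → (x'≢y' : x' ≢ y') (ψ : DelIso K x y L x' y') → K ≅ L
  orient {a} {x'} {y'} x~a a≢s a≢t x'≢y' ψ with a ≟ y
  ... | yes a≡y = from-x x~a a≢s a≢t x'≢y' ψ (neighbour-image x~a (inj₁ a≡y))
    where open CubicCards K L K-cubic L-cubic x≢y x'≢y' ψ
  ... | no a≢y = by-image (neighbour-preserved u (trans (adj-sym K a x) x~a))
    where
    open CubicCards K L K-cubic L-cubic x≢y x'≢y' ψ
    to = Inverse.to (proj₁ ψ)
    u = card-vertex (≢-sym (adjacent-≢ K x~a)) a≢y
    ψ-swapped = DelIso-swapʳ {K = K} {L} ψ
    by-image : adj L (proj₁ (to u)) x' ≡ true ⊎ adj L (proj₁ (to u)) y' ≡ true → K ≅ L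
    by-image (inj₁ u′~x') = from-x x~a a≢s a≢t x'≢y' ψ
      (subst (λ v → adj L x' v ≡ true) (sym (extend-card to u)) (trans (adj-sym L x' _) u′~x'))
    by-image (inj₂ u′~y') = from-x x~a a≢s a≢t (≢-sym x'≢y') ψ-swapped
      (subst (λ v → adj L y' v ≡ true) (sym (extend-card (Inverse.to (proj₁ ψ-swapped)) u))
             (trans (adj-sym L y' _) u′~y'))

module _ (G : Graph n) (G-cubic : Regular 3 G) where

  adjacency-reconstructed : {x y : Fin n} → adj G x y ≡ true → (R : Graph n) → SameDeck G R
                          → {x' y' : Fin n} → x' ≢ y' → DelIso R x' y' G x y → adj R x' y' ≡ true
  adjacency-reconstructed x~y R deck x'≢y' φ =
    trans (CubicCards.adjacency-preserved R G (reconstruction-regular G R G-cubic deck) G-cubic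
                                          x'≢y' (adjacent-≢ G x~y) φ) x~y

  common-neighbour-reconstructed : {x y : Fin n} → x ≢ y → (R : Graph n) → SameDeck G R
                                 → {x' y' : Fin n} → x' ≢ y' → (φ : DelIso R x' y' G x y) (w : Del n x' y')
                                 → adj G x (proj₁ (Inverse.to (proj₁ φ) w)) ≡ true
                                 → adj G y (proj₁ (Inverse.to (proj₁ φ) w)) ≡ true
                                 → adj R x' (proj₁ w) ≡ true × adj R y' (proj₁ w) ≡ true
  common-neighbour-reconstructed {x} {y} x≢y R deck {x'} {y'} x'≢y' φ w x~z y~z =
    let w~x' , w~y' = CubicCards.common-neighbour-reflected R G (reconstruction-regular G R G-cubic deck) G-cubic
                                                           x'≢y' x≢y φ w
                        (trans (adj-sym G _ x) x~z) (trans (adj-sym G _ y) y~z)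
    in trans (adj-sym R x' (proj₁ w)) w~x' , trans (adj-sym R y' (proj₁ w)) w~y'

  reconstruction-girth≥5 : (H : Graph n) → ¬ (H ≅ G) → SameDeck G H → (R : Graph n) → SameDeck G R → GirthAtLeast 5 R
  reconstruction-girth≥5 H H≇G deck-H R deck ℓ 3≤ℓ ℓ<5 cycle =
    H≇G (≅-trans {K = H} {R} {G} (≅-sym {K = R} {H} (short-cycle-≅ R H R-cubic H-cubic deck-RH short))
                                  (short-cycle-≅ R G R-cubic G-cubic deck-RG short))
    where
    R-cubic : Regular 3 R
    R-cubic = reconstruction-regular G R G-cubic deck
    H-cubic : Regular 3 H
    H-cubic = reconstruction-regular G H G-cubic deck-H
    deck-RG : SameDeck R G
    deck-RG = SameDeck-sym {K = G} {R} deck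
    deck-RH : SameDeck R H
    deck-RH = SameDeck-trans {K = R} {G} {H} deck-RG deck-H
    short : ShortCycle R
    short = short-cycle-of R 3≤ℓ ℓ<5 cycle

lemma2p2 : (n : ℕ) (G : Graph n) → Regular 3 G
         → (Σ (Graph n) λ H → ¬ (H ≅ G) × SameDeck G H)
         → ((x y : Fin n) → adj G x y ≡ true
            → (R : Graph n) → SameDeck G R
            → (x' y' : Fin n) → x' ≢ y' → DelIso R x' y' G x y
            → adj R x' y' ≡ true)
         × ((x y z : Fin n) → x ≢ y → adj G x z ≡ true → adj G y z ≡ true
            → (R : Graph n) → SameDeck G R
            → (x' y' : Fin n) → x' ≢ y' → (φ : DelIso R x' y' G x y)
            → (w : Defs.Del n x' y') → proj₁ (Inverse.to (proj₁ φ) w) ≡ z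
            → (adj R x' (proj₁ w) ≡ true) × (adj R y' (proj₁ w) ≡ true))
         × ((R : Graph n) → SameDeck G R → GirthAtLeast 5 R)
lemma2p2 n G G-cubic (H , H≇G , deck-H) =
  (λ x y x~y R deck x' y' x'≢y' φ → adjacency-reconstructed G G-cubic x~y R deck x'≢y' φ) ,
  (λ x y z x≢y x~z y~z R deck x' y' x'≢y' φ w to-w≡z →
     common-neighbour-reconstructed G G-cubic x≢y R deck x'≢y' φ w
       (subst (λ v → adj G x v ≡ true) (sym to-w≡z) x~z) (subst (λ v → adj G y v ≡ true) (sym to-w≡z) y~z)) ,
  reconstruction-girth≥5 G G-cubic H H≇G deck-H
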